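{- Let $G$ be a strongly connected compressed directed graph that is not a closed path, and let $e$ be a join arc or a split arc of $G$. No omnitig of $G$ traverses $e$ twice.
   Context: Graphs are finite directed multigraphs (parallel arcs and self-loops allowed); $t(e)$, $h(e)$ are tail and head of arc $e$. A path is a walk with distinct nodes except the last may equal the first. A closed path is a graph consisting of a single cycle. A node is a join node if its in-degree exceeds 1, a split node if its out-degree exceeds 1, biunivocal if neither; an arc $e$ is a join arc if $h(e)$ is a join node, a split arc if $t(e)$ is a split node, biunivocal if neither. A graph is compressed if it has no biunivocal nodes and no biunivocal arcs. A walk $W=e_0\dots e_\ell$ is an omnitig if for all $1\le i\le j\le \ell$ there is no non-empty path from $t(e_j)$ to $h(e_{i-1})$ whose first arc differs from $e_j$ and whose last arc differs from $e_{i-1}$. -}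

module Defs where

open import Data.Nat using (ℕ; zero; suc; _<_; _>_)
open import Data.Fin using (Fin; zero; suc; toℕ; fromℕ; inject₁)
open import Data.List using (List; length; filter)
open import Data.Fin.Base using ()
open import Data.List using (allFin)
open import Data.Product using (Σ; ∃; _×_; _,_)
open import Data.Sum using (_⊎_)
open import Relation.Binary.PropositionalEquality using (_≡_; _≢_)
open import Relation.Nullary using (¬_)
import Data.Fin.Properties as FinP

-- A finite directed multigraph: nodes Fin n, arcs Fin m, tail/head maps.
-- Parallel arcs and self-loops are allowed.
record Graph : Set where
  field
    n    : ℕ
    m    : ℕ
    tl   : Fin m → Fin n
    hd   : Fin m → Fin n

module _ (G : Graph) where
  open Graph G

  Node = Fin n
  Arc  = Fin m

  indeg : Node → ℕ
  indeg v = length (filter (λ e → hd e FinP.≟ v) (allFin m))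

  outdeg : Node → ℕ
  outdeg v = length (filter (λ e → tl e FinP.≟ v) (allFin m))

  JoinNode : Node → Set
  JoinNode v = indeg v > 1

  SplitNode : Node → Set
  SplitNode v = outdeg v > 1

  BiunivocalNode : Node → Set
  BiunivocalNode v = ¬ JoinNode v × ¬ SplitNode v

  JoinArc : Arc → Set
  JoinArc e = JoinNode (hd e)

  SplitArc : Arc → Set
  SplitArc e = SplitNode (tl e)

  BiunivocalArc : Arc → Set
  BiunivocalArc e = ¬ JoinArc e × ¬ SplitArc e

  Compressed : Set
  Compressed = (∀ v → ¬ BiunivocalNode v) × (∀ e → ¬ BiunivocalArc e)

  IsWalk : {k : ℕ} → (Fin (suc k) → Arc) → Set
  IsWalk {k} W = (i : Fin k) → hd (W (inject₁ i)) ≡ tl (W (suc i))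

  nodeAt : {k : ℕ} → (Fin (suc k) → Arc) → Fin (suc (suc k)) → Node
  nodeAt W zero    = tl (W zero)
  nodeAt W (suc i) = hd (W i)

  IsPath : {k : ℕ} → (Fin (suc k) → Arc) → Set
  IsPath {k} W = IsWalk W ×
    ((i j : Fin (suc (suc k))) → toℕ i < toℕ j → nodeAt W i ≡ nodeAt W j →
       (i ≡ zero × j ≡ fromℕ (suc k)))

  WalkFromTo : Node → Node → Set
  WalkFromTo u v = Σ ℕ λ k → Σ (Fin (suc k) → Arc) λ W →
    IsWalk W × tl (W zero) ≡ u × hd (W (fromℕ k)) ≡ v

  StronglyConnected : Set
  StronglyConnected = (u v : Node) → u ≡ v ⊎ WalkFromTo u v

  IsClosedPath : Set
  IsClosedPath = Σ ℕ λ k → Σ (Fin (suc k) → Arc) λ W →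
    IsPath W × nodeAt W zero ≡ nodeAt W (fromℕ (suc k)) ×
    ((i j : Fin (suc k)) → W i ≡ W j → i ≡ j) ×
    ((e : Arc) → ∃ λ i → W i ≡ e) ×
    ((v : Node) → ∃ λ i → nodeAt W i ≡ v)

  -- Omnitig W = e_0 … e_ℓ: for all 1 ≤ i ≤ j ≤ ℓ there is no non-empty path
  -- from t(e_j) to h(e_{i-1}) whose first arc differs from e_j and whose last
  -- arc differs from e_{i-1}.  (Here a = i-1, b = j, so a < b.)
  IsOmnitig : {ℓ : ℕ} → (Fin (suc ℓ) → Arc) → Set
  IsOmnitig {ℓ} W = IsWalk W ×
    ((a b : Fin (suc ℓ)) → toℕ a < toℕ b →
      ¬ (Σ ℕ λ k → Σ (Fin (suc k) → Arc) λ P →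
           IsPath P × tl (P zero) ≡ tl (W b) × hd (P (fromℕ k)) ≡ hd (W a) ×
           P zero ≢ W b × P (fromℕ k) ≢ W a))

  TraversesTwice : {ℓ : ℕ} → (Fin (suc ℓ) → Arc) → Arc → Set
  TraversesTwice {ℓ} W e = Σ (Fin (suc ℓ)) λ i → Σ (Fin (suc ℓ)) λ j →
    i ≢ j × W i ≡ e × W j ≡ e

-- Let e = W i = W j with i < j be a join arc, and g ≠ e another arc into h(e). Take the last
-- position a ∈ [i, j) whose arc enters h(e), and let T be the set of tails of W(a+1), …, W j;
-- it contains h(e). A walk from h(e) to t(g), cut after its last visit to T and made loop-free,
-- followed by g, is a path from some t(W b) ∈ T, a < b ≤ j, to h(W i). It leaves T at once, so
-- its first arc is W b only if it is g, which the choice of a excludes; its last arc g is not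
-- W i = e. This contradicts the omnitig property for the pair (i, b). Split arcs are join arcs
-- of the reversed graph, and reversing graph and walk together preserves omnitigs.
module Submission where

open import Defs
open import Data.Nat using (ℕ; zero; suc; _<_; _≤_; z≤n; s≤s; _<?_; _≤?_)
open import Data.Nat.Properties
  using (≤-refl; <⇒≤; <⇒≱; <⇒≢; ≤-<-trans; <-≤-trans; m≤n⇒m<n∨m≡n; m<1+n⇒m≤n; m<n⇒m<1+n;
         n<1+n; ∸-monoʳ-<; <-cmp)
  renaming (_≟_ to _≟ℕ_)
open import Data.Fin using (Fin; zero; suc; toℕ; fromℕ; inject₁; opposite; lower₁)
open import Data.Fin.Properties
  using (toℕ-injective; toℕ<n; toℕ≤pred[n]; toℕ-fromℕ; toℕ-lower₁; inject₁-lower₁;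
         opposite-prop; opposite-involutive; any?)
  renaming (_≟_ to _≟ᶠ_)
open import Data.List using (List; []; _∷_; _++_; [_]; length; filter; allFin; lookup)
open import Data.List.Relation.Unary.All as All using (All; []; _∷_)
open import Data.List.Relation.Unary.All.Properties using (¬Any⇒All¬)
open import Data.List.Relation.Unary.Any using (here; there)
open import Data.List.Relation.Unary.Unique.Propositional using (Unique; []; _∷_)
open import Data.List.Relation.Unary.Unique.Propositional.Properties using (++⁺; filter⁺; allFin⁺)
open import Data.List.Membership.Propositional using (_∈_)
open import Data.List.Membership.Propositional.Properties using (∈-filter⁻)
open import Data.List.Membership.DecPropositional as DecMembership using ()
open import Data.Product using (∃; _×_; _,_; proj₁; proj₂)
open import Data.Sum as Sum using (_⊎_; inj₁; inj₂; [_,_]′)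
open import Data.Empty using (⊥; ⊥-elim)
open import Function using (_∘_)
open import Relation.Nullary using (¬_; yes; no)
open import Relation.Nullary.Decidable using (_×-dec_)
open import Relation.Unary using (Decidable; ∁)
open import Relation.Binary using (tri<; tri≈; tri>; DecidableEquality)
open import Relation.Binary.PropositionalEquality
  using (_≡_; _≢_; refl; sym; trans; cong; subst; subst₂)

greatest-below : {P : ℕ → Set} → Decidable P → ∀ {i} j → P i → i < j →
                 ∃ λ c → i ≤ c × c < j × P c × (∀ {d} → c < d → d < j → ¬ P d)
greatest-below {P = P} P? (suc j) Pi i<1+j with P? j
... | yes Pj = j , m<1+n⇒m≤n i<1+j , n<1+n j , Pj ,
               λ j<d d<1+j → ⊥-elim (<⇒≱ j<d (m<1+n⇒m≤n d<1+j))
... | no ¬Pj with m≤n⇒m<n∨m≡n (m<1+n⇒m≤n i<1+j)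
...   | inj₂ refl = ⊥-elim (¬Pj Pi)
...   | inj₁ i<j with greatest-below P? j Pi i<j
...     | c , i≤c , c<j , Pc , none = c , i≤c , m<n⇒m<1+n c<j , Pc ,
          λ {d} c<d d<1+j → [ none c<d , (λ d≡j → subst (¬_ ∘ P) (sym d≡j) ¬Pj) ]′
                              (m≤n⇒m<n∨m≡n (m<1+n⇒m≤n d<1+j))

greatest-index-below : ∀ {n} {Q : Fin n → Set} → Decidable Q →
  ∀ {i j : Fin n} → Q i → toℕ i < toℕ j →
  ∃ λ c → toℕ i ≤ toℕ c × toℕ c < toℕ j × Q c × (∀ d → toℕ c < toℕ d → toℕ d < toℕ j → ¬ Q d)
greatest-index-below Q? {i} {j} Qi i<j
  with greatest-below (λ k → any? λ x → (toℕ x ≟ℕ k) ×-dec Q? x) (toℕ j) (i , refl , Qi) i<j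
... | _ , i≤c , c<j , (c , refl , Qc) , none =
  c , i≤c , c<j , Qc , λ d c<d d<j Qd → none c<d d<j (d , refl , Qd)

opposite-inject₁ : ∀ {n} (i : Fin n) → opposite (inject₁ i) ≡ suc (opposite i)
opposite-inject₁ {suc n} zero    = refl
opposite-inject₁ {suc n} (suc i) = cong inject₁ (opposite-inject₁ i)

opposite-fromℕ : ∀ n → opposite (fromℕ n) ≡ zero
opposite-fromℕ zero    = refl
opposite-fromℕ (suc n) = cong inject₁ (opposite-fromℕ n)

opposite-reverses-< : ∀ {n} {i j : Fin n} → toℕ i < toℕ j → toℕ (opposite j) < toℕ (opposite i)
opposite-reverses-< {i = i} {j} i<j =
  subst₂ _<_ (sym (opposite-prop j)) (sym (opposite-prop i)) (∸-monoʳ-< (s≤s i<j) (toℕ<n j))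

nth : {A : Set} → A → List A → ℕ → A
nth d []       _       = d
nth d (x ∷ xs) zero    = x
nth d (x ∷ xs) (suc p) = nth d xs p

module _ {A : Set} where

  nth-∈ : ∀ d (xs : List A) {p} → p < length xs → nth d xs p ∈ xs
  nth-∈ d (x ∷ xs) {zero}  _       = here refl
  nth-∈ d (x ∷ xs) {suc p} (s≤s p<) = there (nth-∈ d xs p<)

  nth-++ˡ : ∀ d (xs : List A) {ys p} → p < length xs → nth d (xs ++ ys) p ≡ nth d xs p
  nth-++ˡ d (x ∷ xs) {p = zero}  _        = refl
  nth-++ˡ d (x ∷ xs) {p = suc p} (s≤s p<) = nth-++ˡ d xs p<

  index-∷ʳ : ∀ (xs : List A) {z p} → p < length (xs ++ [ z ]) →
             p < length xs ⊎ suc p ≡ length (xs ++ [ z ])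
  index-∷ʳ []       {p = zero}  _        = inj₂ refl
  index-∷ʳ []       {p = suc _} (s≤s ())
  index-∷ʳ (x ∷ xs) {p = zero}  _        = inj₁ (s≤s z≤n)
  index-∷ʳ (x ∷ xs) {p = suc p} (s≤s p<) = Sum.map s≤s (cong suc) (index-∷ʳ xs p<)

  Unique⇒nth-injective : ∀ d {xs : List A} → Unique xs → ∀ {p q} → p < q → q < length xs →
                         nth d xs p ≢ nth d xs q
  Unique⇒nth-injective d {x ∷ xs} (x∉xs ∷ _) {zero} {suc q} _ (s≤s q<) x≡ =
    All.lookup x∉xs (nth-∈ d xs q<) x≡
  Unique⇒nth-injective d {x ∷ xs} (_ ∷ xs!) {suc p} {suc q} (s≤s p<q) (s≤s q<) =
    Unique⇒nth-injective d xs! p<q q<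

  EndsOnlyRepeat : A → List A → Set
  EndsOnlyRepeat u ys = ∀ {i j} → i < j → j ≤ length ys →
    nth u (u ∷ ys) i ≡ nth u (u ∷ ys) j → i ≡ 0 × j ≡ length ys

  ends-only-repeat : ∀ {u z} (xs : List A) → Unique (u ∷ xs) → Unique (xs ++ [ z ]) →
                     EndsOnlyRepeat u (xs ++ [ z ])
  ends-only-repeat xs u∷xs! _ {zero} {suc j} _ j< u≡
    with index-∷ʳ xs j<
  ... | inj₂ last = refl , last
  ... | inj₁ j<|xs| = ⊥-elim (Unique⇒nth-injective _ u∷xs! (s≤s z≤n) (s≤s j<|xs|)
                                (trans u≡ (nth-++ˡ _ xs j<|xs|)))
  ends-only-repeat xs _ xs∷z! {suc i} {suc j} (s≤s i<j) j< eq =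
    ⊥-elim (Unique⇒nth-injective _ xs∷z! i<j j< eq)

  separated-ends-only-repeat : {T : A → Set} {u z : A} (xs : List A) → T u → T z →
    All (∁ T) xs → Unique xs → EndsOnlyRepeat u (xs ++ [ z ])
  separated-ends-only-repeat {T} xs Tu Tz avoid xs! =
    ends-only-repeat xs (All.map (λ ¬Tx u≡x → ¬Tx (subst T u≡x Tu)) avoid ∷ xs!)
      (++⁺ xs! ([] ∷ []) λ { (x∈xs , here refl) → All.lookup avoid x∈xs Tz })

distinct-member : {A : Set} → DecidableEquality A → (xs : List A) → Unique xs → 1 < length xs →
                  (y : A) → ∃ λ x → x ∈ xs × x ≢ y
distinct-member _≟_ (x ∷ x′ ∷ _) ((x≢x′ ∷ _) ∷ _) _ y with x ≟ y
... | no x≢y    = x , here refl , x≢y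
... | yes refl  = x′ , there (here refl) , x≢x′ ∘ sym
distinct-member _ (_ ∷ []) _ (s≤s ()) _

module _ (G : Graph) where
  open Graph G

  another-in-arc : (e : Arc G) → JoinArc G e → ∃ λ g → hd g ≡ hd e × g ≢ e
  another-in-arc e join
    with distinct-member _≟ᶠ_ _ (filter⁺ (λ a → hd a ≟ᶠ hd e) (allFin⁺ m)) join e
  ... | g , g∈ , g≢e = g , proj₂ (∈-filter⁻ (λ a → hd a ≟ᶠ hd e) {xs = allFin m} g∈) , g≢e

module Walks (G : Graph) where
  open Graph G

  data Walk : Node G → Node G → Set where
    []   : ∀ {x} → Walk x x
    cons : ∀ {x y} (a : Arc G) → tl a ≡ x → Walk (hd a) y → Walk x y

  nodes : ∀ {x y} → Walk x y → List (Node G)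
  nodes {x} []           = [ x ]
  nodes {x} (cons _ _ w) = x ∷ nodes w

  arcs : ∀ {x y} → Walk x y → List (Arc G)
  arcs []           = []
  arcs (cons a _ w) = a ∷ arcs w

  snoc : ∀ {x} (a : Arc G) → Walk x (tl a) → Walk x (hd a)
  snoc a []           = cons a refl []
  snoc a (cons b e w) = cons b e (snoc a w)

  All-start : ∀ {P : Node G → Set} {x y} (w : Walk x y) → All P (nodes w) → P x
  All-start []           = All.head
  All-start (cons _ _ _) = All.head

  nodes-snoc : ∀ {x} (a : Arc G) (w : Walk x (tl a)) → nodes (snoc a w) ≡ nodes w ++ [ hd a ]
  nodes-snoc a []               = refl
  nodes-snoc a (cons {x} b e w) = cong (x ∷_) (nodes-snoc a w)

  length-nodes : ∀ {x y} (w : Walk x y) → length (nodes w) ≡ suc (length (arcs w))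
  length-nodes []           = refl
  length-nodes (cons _ _ w) = cong suc (length-nodes w)

  fromWalkFromTo : ∀ {x y} → WalkFromTo G x y → Walk x y
  fromWalkFromTo (k , P , isWalk , refl , refl) = go k P isWalk
    where
      go : ∀ k (P : Fin (suc k) → Arc G) → IsWalk G P → Walk (tl (P zero)) (hd (P (fromℕ k)))
      go zero    P _      = cons (P zero) refl []
      go (suc k) P isWalk = cons (P zero) refl
        (subst (λ x → Walk x _) (sym (isWalk zero)) (go k (P ∘ suc) (isWalk ∘ suc)))

  isWalk-lookup : ∀ {y} (a : Arc G) (w : Walk (hd a) y) → IsWalk G (lookup (a ∷ arcs w))
  isWalk-lookup a (cons b e w) zero    = sym e
  isWalk-lookup a (cons b e w) (suc i) = isWalk-lookup b w i

  lookup-snoc : ∀ {x} (a g : Arc G) (w : Walk x (tl g)) →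
    lookup (a ∷ arcs (snoc g w)) (fromℕ (length (arcs (snoc g w)))) ≡ g
  lookup-snoc a g []           = refl
  lookup-snoc a g (cons b e w) = lookup-snoc b g w

  hd-lookup : ∀ {y} d (a : Arc G) (w : Walk (hd a) y) (i : Fin (suc (length (arcs w)))) →
              hd (lookup (a ∷ arcs w) i) ≡ nth d (nodes w) (toℕ i)
  hd-lookup d a []           zero    = refl
  hd-lookup d a (cons b e w) zero    = refl
  hd-lookup d a (cons b e w) (suc i) = hd-lookup d b w i

  nodeAt-lookup : ∀ {y} (a : Arc G) (w : Walk (hd a) y) (i : Fin (suc (suc (length (arcs w))))) →
                  nodeAt G (lookup (a ∷ arcs w)) i ≡ nth (tl a) (tl a ∷ nodes w) (toℕ i)
  nodeAt-lookup a w zero    = refl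
  nodeAt-lookup a w (suc i) = hd-lookup (tl a) a w i

  isPath-lookup : ∀ {y} (a : Arc G) (w : Walk (hd a) y) → EndsOnlyRepeat (tl a) (nodes w) →
                  IsPath G (lookup (a ∷ arcs w))
  isPath-lookup a w ends = isWalk-lookup a w , distinct
    where
      distinct : ∀ i j → toℕ i < toℕ j →
                 nodeAt G (lookup (a ∷ arcs w)) i ≡ nodeAt G (lookup (a ∷ arcs w)) j →
                 i ≡ zero × j ≡ fromℕ (suc (length (arcs w)))
      distinct i j i<j eq
        with ends i<j (subst (toℕ j ≤_) (sym (length-nodes w)) (toℕ≤pred[n] j))
                  (trans (sym (nodeAt-lookup a w i)) (trans eq (nodeAt-lookup a w j)))
      ... | i≡0 , j≡last = toℕ-injective i≡0 ,
        toℕ-injective (trans j≡last (trans (length-nodes w) (sym (toℕ-fromℕ _))))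

  module LoopErasure {T : Node G → Set} (T? : Decidable T) where
    open DecMembership (_≟ᶠ_ {n}) using (_∈?_)

    record Avoiding (x y : Node G) : Set where
      constructor avoiding
      field
        walk   : Walk x y
        avoids : All (∁ T) (nodes walk)
        simple : Unique (nodes walk)

    suffix : ∀ {x y z} (p : Avoiding z y) → x ∈ nodes (Avoiding.walk p) → Avoiding x y
    suffix p@(avoiding []           _ _) (here refl) = p
    suffix p@(avoiding (cons _ _ _) _ _) (here refl) = p
    suffix (avoiding (cons _ _ w) (_ ∷ avoid) (_ ∷ simple)) (there x∈) =
      suffix (avoiding w avoid simple) x∈

    prepend : ∀ {x y} (a : Arc G) → tl a ≡ x → ¬ T x → Avoiding (hd a) y → Avoiding x y
    prepend {x} a e ¬Tx p@(avoiding w avoid simple) with x ∈? nodes w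
    ... | yes x∈ = suffix p x∈
    ... | no x∉  = avoiding (cons a e w) (¬Tx ∷ avoid) (¬Any⇒All¬ _ x∉ ∷ simple)

    last-exit : ∀ {x y} → Walk x y → ¬ T y → (∃ λ a → T (tl a) × Avoiding (hd a) y) ⊎ Avoiding x y
    last-exit []           ¬Ty = inj₂ (avoiding [] (¬Ty ∷ []) ([] ∷ []))
    last-exit {x} (cons a e w) ¬Ty with last-exit w ¬Ty
    ... | inj₁ exit = inj₁ exit
    ... | inj₂ p with T? x
    ...   | yes Tx = inj₁ (a , subst T (sym e) Tx , p)
    ...   | no ¬Tx = inj₂ (prepend a e ¬Tx p)

  record Reentry (T : Node G → Set) (g : Arc G) : Set where
    constructor reentry
    field
      {len}     : ℕ
      arc       : Fin (suc len) → Arc G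
      isPath    : IsPath G arc
      starts-in : T (tl (arc zero))
      ends-with : arc (fromℕ len) ≡ g
      leaves    : T (hd (arc zero)) → arc zero ≡ g

  reentry-path : {T : Node G → Set} → Decidable T → StronglyConnected G →
                 (g : Arc G) → T (hd g) → Reentry T g
  reentry-path {T} T? sc g Thg with T? (tl g)
  ... | yes Ttg = reentry (lookup [ g ])
    (isPath-lookup g [] (ends-only-repeat [] ([] ∷ []) ([] ∷ []))) Ttg refl (λ _ → refl)
  ... | no ¬Ttg with sc (hd g) (tl g)
  ...   | inj₁ hd≡tl = ⊥-elim (¬Ttg (subst T hd≡tl Thg))
  ...   | inj₂ walk with LoopErasure.last-exit T? (fromWalkFromTo walk) ¬Ttg
  ...     | inj₂ (LoopErasure.avoiding w avoid _) = ⊥-elim (All-start w avoid Thg)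
  ...     | inj₁ (a , Ta , LoopErasure.avoiding w avoid simple) =
    reentry (lookup (a ∷ arcs (snoc g w)))
      (isPath-lookup a (snoc g w) (subst (EndsOnlyRepeat (tl a)) (sym (nodes-snoc g w))
        (separated-ends-only-repeat (nodes w) Ta Thg avoid simple)))
      Ta (lookup-snoc a g w) λ Tha → ⊥-elim (All-start w avoid Tha)

reverse : Graph → Graph
reverse G = record G { tl = Graph.hd G ; hd = Graph.tl G }

module _ (G : Graph) where
  open Graph G

  nodeAt-inject₁ : ∀ {k} {W : Fin (suc k) → Arc G} → IsWalk G W →
                   (i : Fin (suc k)) → nodeAt G W (inject₁ i) ≡ tl (W i)
  nodeAt-inject₁ isWalk zero    = refl
  nodeAt-inject₁ isWalk (suc i) = isWalk i

  reverse-isWalk : ∀ {k} {W : Fin (suc k) → Arc G} → IsWalk G W → IsWalk (reverse G) (W ∘ opposite)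
  reverse-isWalk {W = W} isWalk i =
    trans (cong (tl ∘ W) (opposite-inject₁ i)) (sym (isWalk (opposite i)))

  nodeAt-reverse : ∀ {k} {W : Fin (suc k) → Arc G} → IsWalk G W → (i : Fin (suc (suc k))) →
                   nodeAt (reverse G) (W ∘ opposite) i ≡ nodeAt G W (opposite i)
  nodeAt-reverse isWalk zero    = refl
  nodeAt-reverse isWalk (suc i) = sym (nodeAt-inject₁ isWalk (opposite i))

  reverse-isPath : ∀ {k} {P : Fin (suc k) → Arc G} → IsPath G P → IsPath (reverse G) (P ∘ opposite)
  reverse-isPath {k} {P} (isWalk , distinct) = reverse-isWalk {W = P} isWalk , reversed
    where
      reversed : ∀ i j → toℕ i < toℕ j → _ → i ≡ zero × j ≡ fromℕ (suc k)
      reversed i j i<j eq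
        with distinct (opposite j) (opposite i) (opposite-reverses-< i<j)
               (trans (sym (nodeAt-reverse isWalk j)) (trans (sym eq) (nodeAt-reverse isWalk i)))
      ... | j′≡0 , i′≡last =
        trans (sym (opposite-involutive i))
              (trans (cong opposite i′≡last) (opposite-fromℕ (suc k))) ,
        trans (sym (opposite-involutive j)) (cong opposite j′≡0)

module _ (G : Graph) where
  open Graph G

  reverse-stronglyConnected : StronglyConnected G → StronglyConnected (reverse G)
  reverse-stronglyConnected sc u v with sc v u
  ... | inj₁ v≡u = inj₁ (sym v≡u)
  ... | inj₂ (k , P , isWalk , starts , ends) =
    inj₂ (k , P ∘ opposite , reverse-isWalk G {W = P} isWalk , ends ,
          trans (cong (tl ∘ P) (opposite-fromℕ k)) starts)

  reverse-omnitig : ∀ {ℓ} {W : Fin (suc ℓ) → Arc G} →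
                    IsOmnitig G W → IsOmnitig (reverse G) (W ∘ opposite)
  reverse-omnitig {W = W} (isWalk , no-bypass) = reverse-isWalk G {W = W} isWalk ,
    λ { a b a<b (k , P , isPath , starts , ends , first≢ , last≢) →
          no-bypass (opposite b) (opposite a) (opposite-reverses-< a<b)
            (k , P ∘ opposite , reverse-isPath (reverse G) {P = P} isPath , ends ,
             trans (cong (hd ∘ P) (opposite-fromℕ k)) starts , last≢ ,
             first≢ ∘ trans (cong P (sym (opposite-fromℕ k)))) }

module _ {G : Graph} (sc : StronglyConnected G) {ℓ : ℕ} {W : Fin (suc ℓ) → Arc G}
         (omnitig : IsOmnitig G W) where
  open Graph G
  open Walks G using (Reentry; reentry; reentry-path)

  TailWithin : Fin (suc ℓ) → Fin (suc ℓ) → Node G → Set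
  TailWithin a j x = ∃ λ b → toℕ a < toℕ b × toℕ b ≤ toℕ j × tl (W b) ≡ x

  tailWithin? : ∀ a j → Decidable (TailWithin a j)
  tailWithin? a j x = any? λ b → (toℕ a <? toℕ b) ×-dec (toℕ b ≤? toℕ j) ×-dec (tl (W b) ≟ᶠ x)

  hd∈TailWithin : ∀ {a c j} → toℕ a ≤ toℕ c → toℕ c < toℕ j → TailWithin a j (hd (W c))
  hd∈TailWithin {a} {c} {j} a≤c c<j =
    suc c′ , subst (toℕ a <_) (sym c′+1≡) (s≤s a≤c) , subst (_≤ toℕ j) (sym c′+1≡) c<j ,
    sym (subst (λ d → hd (W d) ≡ tl (W (suc c′))) (inject₁-lower₁ c ℓ≢c) (proj₁ omnitig c′))
    where
      ℓ≢c : ℓ ≢ toℕ c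
      ℓ≢c ℓ≡c = <⇒≢ (<-≤-trans c<j (toℕ≤pred[n] j)) (sym ℓ≡c)
      c′ = lower₁ c ℓ≢c
      c′+1≡ : suc (toℕ c′) ≡ suc (toℕ c)
      c′+1≡ = cong suc (toℕ-lower₁ c ℓ≢c)

  join-arc-traversed-once : ∀ {e i j} → JoinArc G e → toℕ i < toℕ j → W i ≡ e → W j ≡ e → ⊥
  join-arc-traversed-once {e} {i} {j} join i<j Wi≡e Wj≡e
    with another-in-arc G e join | greatest-index-below (λ c → hd (W c) ≟ᶠ hd e) (cong hd Wi≡e) i<j
  ... | g , g-enters , g≢e | a , i≤a , a<j , a-enters , a-last =
    bypass (reentry-path (tailWithin? a j) sc g (subst T (sym g-enters) hd-e∈T))
    where
      T = TailWithin a j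

      hd-e∈T : T (hd e)
      hd-e∈T = subst T a-enters (hd∈TailWithin ≤-refl a<j)

      Wj-enters : ∀ {b} → toℕ b ≡ toℕ j → hd (W b) ≡ hd e
      Wj-enters b≡j = cong hd (trans (cong W (toℕ-injective b≡j)) Wj≡e)

      hd∈T : ∀ {b} → toℕ a < toℕ b → toℕ b ≤ toℕ j → T (hd (W b))
      hd∈T a<b b≤j with m≤n⇒m<n∨m≡n b≤j
      ... | inj₁ b<j = hd∈TailWithin (<⇒≤ a<b) b<j
      ... | inj₂ b≡j = subst T (sym (Wj-enters b≡j)) hd-e∈T

      later-arc≢g : ∀ {b} → toℕ a < toℕ b → toℕ b ≤ toℕ j → W b ≢ g
      later-arc≢g a<b b≤j Wb≡g with m≤n⇒m<n∨m≡n b≤j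
      ... | inj₁ b<j = a-last _ a<b b<j (trans (cong hd Wb≡g) g-enters)
      ... | inj₂ b≡j = g≢e (trans (sym Wb≡g) (trans (cong W (toℕ-injective b≡j)) Wj≡e))

      bypass : Reentry T g → ⊥
      bypass (reentry P isPath (b , a<b , b≤j , Wb≡) ends leaves) =
        proj₂ omnitig i b (≤-<-trans i≤a a<b)
          (_ , P , isPath , sym Wb≡ , trans (cong hd ends) (trans g-enters (sym (cong hd Wi≡e))) ,
           (λ P₀≡Wb → later-arc≢g a<b b≤j (trans (sym P₀≡Wb)
                        (leaves (subst T (cong hd (sym P₀≡Wb)) (hd∈T a<b b≤j))))) ,
           λ Pₖ≡Wi → g≢e (trans (sym ends) (trans Pₖ≡Wi Wi≡e)))

join-or-split-arc-traversed-once : ∀ {G} → StronglyConnected G → ∀ {ℓ} {W : Fin (suc ℓ) → Arc G} →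
  IsOmnitig G W → ∀ {e i j} → JoinArc G e ⊎ SplitArc G e → toℕ i < toℕ j → W i ≡ e → W j ≡ e → ⊥
join-or-split-arc-traversed-once sc omnitig (inj₁ join) = join-arc-traversed-once sc omnitig join
join-or-split-arc-traversed-once {G} sc {W = W} omnitig {i = i} {j} (inj₂ split) i<j Wi≡e Wj≡e =
  -- JoinArc (reverse G) e unfolds to SplitArc G e.
  join-arc-traversed-once (reverse-stronglyConnected G sc) (reverse-omnitig G omnitig) split
    (opposite-reverses-< i<j) (trans (cong W (opposite-involutive j)) Wj≡e)
    (trans (cong W (opposite-involutive i)) Wi≡e)

lemma11 : (G : Graph) → StronglyConnected G → Compressed G → ¬ IsClosedPath G →
    (e : Arc G) → JoinArc G e ⊎ SplitArc G e →
    {ℓ : ℕ} (W : Fin (suc ℓ) → Arc G) → IsOmnitig G W → ¬ TraversesTwice G W e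
lemma11 G sc _ _ e join-or-split W omnitig (i , j , i≢j , Wi≡e , Wj≡e) with <-cmp (toℕ i) (toℕ j)
... | tri< i<j _ _ = join-or-split-arc-traversed-once sc omnitig join-or-split i<j Wi≡e Wj≡e
... | tri≈ _ i≡j _ = i≢j (toℕ-injective i≡j)
... | tri> _ _ j<i = join-or-split-arc-traversed-once sc omnitig join-or-split j<i Wj≡e Wi≡e
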